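{- Fix integers $n\ge 2$ and $d\ge 2$. Consider either of the following two cases. (1) $G_d=G(d,1,n)$, $G_\infty=G(\infty,1,n)$, $c=[(1\,2\,\cdots\,n);(0,\ldots,0,1)]\in G_d$ and $\widetilde c=[(1\,2\,\cdots\,n);(0,\ldots,0,1)]\in G_\infty$. (2) $G_d=G(d,d,n)$, $G_\infty=G(\infty,\infty,n)$, $c=[(1\,2\,\cdots\,n-1)(n);(0,\ldots,0,1,-1)]\in G_d$ and $\widetilde c=[(1\,2\,\cdots\,n-1)(n);(0,\ldots,0,1,-1)]\in G_\infty$. Then for any reflection factorization $(t_1,\ldots,t_k)$ of $c$ in $G_d$ (i.e. each $t_i$ is a reflection of $G_d$ and $t_1\cdots t_k=c$), there exists a reflection factorization $(\widetilde t_1,\ldots,\widetilde t_k)$ of $\widetilde c$ in $G_\infty$ (each $\widetilde t_i$ a reflection of $G_\infty$ and $\widetilde t_1\cdots\widetilde t_k=\widetilde c$) such that $\pi_d(\widetilde t_i)=t_i$ for all $i$.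
   Context: For $R=\mathbb{Z}$ or $R=\mathbb{Z}/d\mathbb{Z}$, the wreath product $R\wr \mathfrak{S}_n$ consists of pairs $[w;a]$ with $w$ a permutation of $\{1,\ldots,n\}$ and $a=(a_1,\ldots,a_n)\in R^n$, with multiplication $[w;a]\cdot[u;b]=[wu;u(a)+b]$ where $u(a)=(a_{u(1)},\ldots,a_{u(n)})$. The weight of $[w;a]$ is $a_1+\cdots+a_n$. Define $G(d,1,n)=\mathbb{Z}/d\mathbb{Z}\wr\mathfrak{S}_n$ and $G(d,d,n)$ its subgroup of weight-$0$ elements; define $G(\infty,1,n)=\mathbb{Z}\wr\mathfrak{S}_n$ and $G(\infty,\infty,n)$ its subgroup of weight-$0$ elements. (These correspond to monomial matrices: $w$ is the underlying permutation and $a_k$ is the exponent of $\exp(2\pi i/d)$, resp. of a formal variable $x$, in the nonzero entry of column $k$.) Write $\varepsilon$ for the identity permutation. For $i<j$ and $k\in R$, let $[(i\,j);k]$ denote $[(i\,j);v]$ where $v$ has $-k$ in position $i$, $k$ in position $j$, and $0$ elsewhere (transposition-like reflections). The reflections of $G(d,1,n)$ are all $[(i\,j);k]$ with $k\in\mathbb{Z}/d\mathbb{Z}$ together with the diagonal reflections $[\varepsilon;k e_i]$ ($k e_i$ the vector with $k$ in position $i$, $0$ elsewhere) with $k\not\equiv 0 \pmod d$; the reflections of $G(d,d,n)$ are the $[(i\,j);k]$, $k\in\mathbb{Z}/d\mathbb{Z}$. The reflections of $G(\infty,1,n)$ are all $[(i\,j);k]$ with $k\in\mathbb{Z}$ together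 with all $[\varepsilon;ke_i]$ with $k\in\mathbb{Z}\setminus\{0\}$; the reflections of $G(\infty,\infty,n)$ are the $[(i\,j);k]$, $k\in\mathbb{Z}$. The map $\pi_d:G(\infty,1,n)\to G(d,1,n)$, $[w;a]\mapsto[w;a\bmod d]$, is a surjective homomorphism restricting to $G(\infty,\infty,n)\to G(d,d,n)$. -}

module Defs where

open import Data.Nat as ℕ using (ℕ; zero; suc; _∸_)
open import Data.Nat.Properties using (_<?_; _≟_)
open import Data.Fin as Fin using (Fin; toℕ; fromℕ<)
open import Data.Integer as ℤ using (ℤ; +_; -_; _-_; 0ℤ; 1ℤ; -1ℤ)
open import Data.Integer.Divisibility as ℤDiv using ()
open import Data.List using (List; []; _∷_)
open import Data.Product using (Σ; ∃; _×_; _,_)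
open import Data.Sum using (_⊎_)
open import Relation.Nullary using (¬_; yes; no)
open import Relation.Binary.PropositionalEquality using (_≡_)

-- An element [w;a] of a wreath product R ≀ S_n, with entries represented in ℤ.
-- For R = ℤ/dℤ, entries are ℤ-representatives and equality is taken mod d
-- (quotient as a setoid); for R = ℤ, equality is literal.
record W (n : ℕ) : Set where
  constructor ⟦_∶_⟧
  field
    perm : Fin n → Fin n
    vec  : Fin n → ℤ
open W public

-- [w;a]·[u;b] = [wu; u(a)+b],  u(a) = (a_{u(1)},…,a_{u(n)})
_·_ : ∀ {n} → W n → W n → W n
x · y = ⟦ (λ k → perm x (perm y k)) ∶ (λ k → vec x (perm y k) ℤ.+ vec y k) ⟧

one : ∀ {n} → W n
one = ⟦ (λ k → k) ∶ (λ _ → 0ℤ) ⟧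

prod : ∀ {n} → List (W n) → W n
prod []       = one
prod (t ∷ ts) = t · prod ts

_≡[_]_ : ℤ → ℕ → ℤ → Set
x ≡[ d ] y = (+ d) ℤDiv.∣ (x - y)

_≈[_]_ : ∀ {n} → W n → ℕ → W n → Set
x ≈[ d ] y = (∀ k → perm x k ≡ perm y k) × (∀ k → vec x k ≡[ d ] vec y k)

_≈∞_ : ∀ {n} → W n → W n → Set
x ≈∞ y = (∀ k → perm x k ≡ perm y k) × (∀ k → vec x k ≡ vec y k)

Proj : ∀ {n} → ℕ → W n → W n → Set
Proj d x̃ x = x̃ ≈[ d ] x

swap : ∀ {n} → Fin n → Fin n → Fin n → Fin n
swap i j l with toℕ l ≟ toℕ i | toℕ l ≟ toℕ j
... | yes _ | _     = j
... | no _  | yes _ = i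
... | no _  | no _  = l

tr : ∀ {n} → Fin n → Fin n → ℤ → W n
tr i j k = ⟦ swap i j ∶ v ⟧
  where
  v : Fin _ → ℤ
  v l with toℕ l ≟ toℕ i | toℕ l ≟ toℕ j
  ... | yes _ | _     = - k
  ... | no _  | yes _ = k
  ... | no _  | no _  = 0ℤ

diag : ∀ {n} → Fin n → ℤ → W n
diag i k = ⟦ (λ l → l) ∶ v ⟧
  where
  v : Fin _ → ℤ
  v l with toℕ l ≟ toℕ i
  ... | yes _ = k
  ... | no _  = 0ℤ

ReflDD : ∀ {n} → ℕ → W n → Set
ReflDD {n} d t = Σ (Fin n) λ i → Σ (Fin n) λ j → Σ ℤ λ k →
  (toℕ i ℕ.< toℕ j) × (t ≈[ d ] tr i j k)

ReflD1 : ∀ {n} → ℕ → W n → Set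
ReflD1 {n} d t = ReflDD d t ⊎
  (Σ (Fin n) λ i → Σ ℤ λ k → (¬ (k ≡[ d ] 0ℤ)) × (t ≈[ d ] diag i k))

ReflII : ∀ {n} → W n → Set
ReflII {n} t = Σ (Fin n) λ i → Σ (Fin n) λ j → Σ ℤ λ k →
  (toℕ i ℕ.< toℕ j) × (t ≈∞ tr i j k)

ReflI1 : ∀ {n} → W n → Set
ReflI1 {n} t = ReflII t ⊎
  (Σ (Fin n) λ i → Σ ℤ λ k → (¬ (k ≡ 0ℤ)) × (t ≈∞ diag i k))

fzero : ∀ {n} → Fin n → Fin n
fzero Fin.zero    = Fin.zero
fzero (Fin.suc _) = Fin.zero

-- the cycle (1 2 ⋯ m) acting on {1,…,n} (0-based: 0 ↦ 1 ↦ ⋯ ↦ m-1 ↦ 0,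
-- points ≥ m fixed); intended for m ≤ n.
cyc : ∀ {n} → ℕ → Fin n → Fin n
cyc {n} m k with suc (toℕ k) <? m | suc (toℕ k) <? n
... | yes _ | yes p = fromℕ< p
... | yes _ | no _  = k
... | no _  | _ with toℕ k <? m
...   | yes _ = fzero k
...   | no _  = k

c₁ : ∀ {n} → W n
c₁ {n} = ⟦ cyc n ∶ v ⟧
  where
  v : Fin n → ℤ
  v l with toℕ l ≟ n ∸ 1
  ... | yes _ = 1ℤ
  ... | no _  = 0ℤ

c₂ : ∀ {n} → W n
c₂ {n} = ⟦ cyc (n ∸ 1) ∶ v ⟧
  where
  v : Fin n → ℤ
  v l with toℕ l ≟ n ∸ 2 | toℕ l ≟ n ∸ 1
  ... | yes _ | _     = 1ℤ
  ... | no _  | yes _ = -1ℤ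
  ... | no _  | no _  = 0ℤ

module Submission where

-- Each tᵢ has a shape (a transposition (i j) or a diagonal position i) and an integer parameter;
-- every reflection of G∞ with that shape and a parameter ≡ it (mod d) lies over tᵢ.  Whatever the
-- parameters, the product of the lifts has the same underlying permutation σ, and its vector is
-- linear in the parameters, so moving the parameters by d·m moves the product by d times an
-- element of the lattice L spanned by these vectors.  Hence it suffices that the discrepancy
-- (product − c̃)/d lies in L.  For every point q, L contains e_{σ q} − e_q, and σ is the cycle
-- underlying c, so e_p − e_q ∈ L for any two points p, q of that cycle.  In case (1), a diagonal
-- factor puts some e_q into L, whence L = ℤⁿ; with transpositions only, the product has weight 0
-- while c̃ has weight 1, impossible mod d ≥ 2.  In case (2), e_n − e_q ∈ L for some q ≠ n, as
-- otherwise the n-th coordinate of every product would be 0 rather than −1 mod d; hence L is the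
-- whole weight-0 lattice, which contains the discrepancy.

open import Defs
open import Data.Empty using (⊥; ⊥-elim)
open import Data.Fin as Fin using (Fin; toℕ; fromℕ; fromℕ<)
import Data.Fin.Properties as FinP
open import Data.Integer as ℤ using (ℤ; +_; -_; _-_; 0ℤ; 1ℤ; -1ℤ; _+_; _*_)
open import Data.Integer.Divisibility.Signed as ℤS using (divides)
import Data.Integer.Properties as ℤP
open import Algebra.Properties.Semiring.Sum ℤP.+-*-semiring
  using (sum; sum-cong-≗; sum-replicate-zero; ∑-distrib-+; *-distribˡ-sum; *-distribʳ-sum)
open import Data.Integer.Tactic.RingSolver using (solve-∀)
open import Data.List using (List; []; _∷_)
open import Data.List.Relation.Binary.Pointwise as Pointwise using (Pointwise; []; _∷_)
open import Data.List.Relation.Unary.All using (All; []; _∷_)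
open import Data.Nat as ℕ using (ℕ; zero; suc; _≤_; _<_; s≤s)
import Data.Nat.Divisibility as ℕD
import Data.Nat.Properties as ℕP
open import Data.Product using (Σ; _×_; _,_; proj₁; proj₂)
open import Data.Sum using (_⊎_; inj₁; inj₂)
open import Data.Unit using (⊤; tt)
open import Function using (_∘_)
open import Relation.Binary.PropositionalEquality
open import Relation.Nullary using (¬_; yes; no; Dec)

module _ {d : ℕ} where

  private
    signed : ∀ x y → x ≡[ d ] y → + d ℤS.∣ (x - y)
    signed x y = ℤS.∣ᵤ⇒∣ {+ d} {x - y}

  ≡[]⇒quotient : ∀ x y → x ≡[ d ] y → Σ ℤ λ q → x - y ≡ q * + d
  ≡[]⇒quotient x y h with signed x y h
  ... | divides q eq = q , eq

  quotient⇒≡[] : ∀ x y q → x - y ≡ q * + d → x ≡[ d ] y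
  quotient⇒≡[] x y q eq = ℤS.∣⇒∣ᵤ (divides q eq)

  ≡[]-sym : ∀ x y → x ≡[ d ] y → y ≡[ d ] x
  ≡[]-sym x y h = ℤS.∣⇒∣ᵤ (subst (+ d ℤS.∣_) (negate x y) (ℤS.∣m⇒∣-m (signed x y h)))
    where
    negate : ∀ x y → - (x - y) ≡ y - x
    negate = solve-∀

  ≡[]-trans : ∀ x y z → x ≡[ d ] y → y ≡[ d ] z → x ≡[ d ] z
  ≡[]-trans x y z h h′ =
    ℤS.∣⇒∣ᵤ (subst (+ d ℤS.∣_) (telescope x y z) (ℤS.∣m∣n⇒∣m+n (signed x y h) (signed y z h′)))
    where
    telescope : ∀ x y z → (x - y) + (y - z) ≡ x - z
    telescope = solve-∀

  +-cong-≡[] : ∀ a b a′ b′ → a ≡[ d ] a′ → b ≡[ d ] b′ → (a + b) ≡[ d ] (a′ + b′)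
  +-cong-≡[] a b a′ b′ h h′ =
    ℤS.∣⇒∣ᵤ (subst (+ d ℤS.∣_) (regroup a b a′ b′) (ℤS.∣m∣n⇒∣m+n (signed a a′ h) (signed b b′ h′)))
    where
    regroup : ∀ a b a′ b′ → (a - a′) + (b - b′) ≡ (a + b) - (a′ + b′)
    regroup = solve-∀

  ≈[]-sym : ∀ {n} {x y : W n} → x ≈[ d ] y → y ≈[ d ] x
  ≈[]-sym {x = x} {y} (p , v) = (sym ∘ p) , (λ k → ≡[]-sym (vec x k) (vec y k) (v k))

  ≈[]-trans : ∀ {n} {x y z : W n} → x ≈[ d ] y → y ≈[ d ] z → x ≈[ d ] z
  ≈[]-trans {x = x} {y} {z} (p , v) (p′ , v′) =
    (λ k → trans (p k) (p′ k)) , (λ k → ≡[]-trans (vec x k) (vec y k) (vec z k) (v k) (v′ k))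

  ·-cong-≈[] : ∀ {n} {x x′ y y′ : W n} → x ≈[ d ] x′ → y ≈[ d ] y′ → (x · y) ≈[ d ] (x′ · y′)
  ·-cong-≈[] {x = x} {x′} {y} {y′} (px , vx) (py , vy) =
    (λ k → trans (cong (perm x) (py k)) (px (perm y′ k))) ,
    (λ k → +-cong-≡[] (vec x (perm y k)) (vec y k) (vec x′ (perm y′ k)) (vec y′ k)
             (subst (λ z → vec x (perm y k) ≡[ d ] vec x′ z) (py k) (vx (perm y k))) (vy k))

  prod-cong-≈[] : ∀ {n} {xs ys : List (W n)} → Pointwise _≈[ d ]_ xs ys → prod xs ≈[ d ] prod ys
  prod-cong-≈[] []       = (λ _ → refl) , (λ _ → quotient⇒≡[] 0ℤ 0ℤ 0ℤ refl)
  prod-cong-≈[] {xs = x ∷ xs} {y ∷ ys} (h ∷ hs) =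
    ·-cong-≈[] {x = x} {y} {prod xs} {prod ys} h (prod-cong-≈[] hs)

≥2∤unit : ∀ {d x} → 2 ≤ d → ℤ.∣ x ∣ ≡ 1 → ¬ (+ d ℤS.∣ x)
≥2∤unit {d} {x} 2≤d ∣x∣≡1 d∣x =
  ℕP.<⇒≢ 2≤d (sym (ℕD.∣1⇒≡1 (subst (d ℕD.∣_) ∣x∣≡1 (ℤS.∣⇒∣ᵤ {+ d} {x} d∣x))))

e : ∀ {n} → Fin n → Fin n → ℤ
e p l with toℕ l ℕP.≟ toℕ p
... | yes _ = 1ℤ
... | no _  = 0ℤ

module _ {n : ℕ} {p l : Fin n} where

  e-≡ : toℕ l ≡ toℕ p → e p l ≡ 1ℤ
  e-≡ l≡p with toℕ l ℕP.≟ toℕ p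
  ... | yes _   = refl
  ... | no  l≢p = ⊥-elim (l≢p l≡p)

  e-≢ : toℕ l ≢ toℕ p → e p l ≡ 0ℤ
  e-≢ l≢p with toℕ l ℕP.≟ toℕ p
  ... | yes l≡p = ⊥-elim (l≢p l≡p)
  ... | no  _   = refl

e-suc : ∀ {n} (p l : Fin n) → e (Fin.suc p) (Fin.suc l) ≡ e p l
e-suc p l with toℕ l ℕP.≟ toℕ p
... | yes l≡p = e-≡ (cong suc l≡p)
... | no  l≢p = e-≢ (l≢p ∘ ℕP.suc-injective)

e-comm : ∀ {n} (p l : Fin n) → e p l ≡ e l p
e-comm p l with toℕ l ℕP.≟ toℕ p
... | yes l≡p = sym (e-≡ (sym l≡p))
... | no  l≢p = sym (e-≢ (l≢p ∘ sym))

e-∘-inverse : ∀ {n} {f g : Fin n → Fin n} → (∀ x → f (g x) ≡ x) → (∀ x → g (f x) ≡ x) →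
              ∀ p l → e p (f l) ≡ e (g p) l
e-∘-inverse {f = f} {g} fg gf p l with toℕ l ℕP.≟ toℕ (g p)
... | yes l≡gp = e-≡ (cong toℕ (trans (cong f (FinP.toℕ-injective l≡gp)) (fg p)))
... | no  l≢gp =
  e-≢ (λ fl≡p → l≢gp (cong toℕ (trans (sym (gf l)) (cong g (FinP.toℕ-injective fl≡p)))))

sum-e-expansion : ∀ {m} (f : Fin m → ℤ) l → sum (λ p → f p * e p l) ≡ f l
sum-e-expansion {suc m} f Fin.zero = begin
  f Fin.zero * 1ℤ + sum (λ p → f (Fin.suc p) * 0ℤ)
    ≡⟨ cong₂ _+_ (ℤP.*-identityʳ (f Fin.zero)) (sum-cong-≗ (ℤP.*-zeroʳ ∘ f ∘ Fin.suc)) ⟩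
  f Fin.zero + sum {m} (λ _ → 0ℤ)
    ≡⟨ cong (λ x → f Fin.zero + x) (sum-replicate-zero m) ⟩
  f Fin.zero + 0ℤ
    ≡⟨ ℤP.+-identityʳ (f Fin.zero) ⟩
  f Fin.zero ∎
  where open ≡-Reasoning
sum-e-expansion f (Fin.suc l) = begin
  f Fin.zero * 0ℤ + sum (λ p → f (Fin.suc p) * e (Fin.suc p) (Fin.suc l))
    ≡⟨ cong₂ _+_ (ℤP.*-zeroʳ (f Fin.zero)) (sum-cong-≗ (λ p → cong (f (Fin.suc p) *_) (e-suc p l))) ⟩
  0ℤ + sum (λ p → f (Fin.suc p) * e p l)
    ≡⟨ ℤP.+-identityˡ (sum (λ p → f (Fin.suc p) * e p l)) ⟩
  sum (λ p → f (Fin.suc p) * e p l)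
    ≡⟨ sum-e-expansion (f ∘ Fin.suc) l ⟩
  f (Fin.suc l) ∎
  where open ≡-Reasoning

sum-e : ∀ {m} (p : Fin m) → sum (e p) ≡ 1ℤ
sum-e p = trans (sum-cong-≗ (λ l → trans (e-comm p l) (sym (ℤP.*-identityˡ (e l p)))))
                (sum-e-expansion (λ _ → 1ℤ) p)

sum-neg : ∀ {m} (f : Fin m → ℤ) → sum (λ l → - f l) ≡ - sum f
sum-neg {zero}  f = refl
sum-neg {suc m} f = trans (cong (λ x → - f Fin.zero + x) (sum-neg (f ∘ Fin.suc)))
                          (sym (ℤP.neg-distrib-+ (f Fin.zero) (sum (f ∘ Fin.suc))))

sum-sub : ∀ {m} (f g : Fin m → ℤ) → sum (λ l → f l - g l) ≡ sum f - sum g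
sum-sub f g = trans (∑-distrib-+ f (λ l → - g l)) (cong (λ x → sum f + x) (sum-neg g))

sum-discrepancy : ∀ {n} d (f g δ : Fin n → ℤ) → (∀ l → f l - g l ≡ δ l * + d) →
                  sum δ * + d ≡ sum f - sum g
sum-discrepancy d f g δ discrepancy =
  trans (*-distribʳ-sum (+ d) δ) (trans (sym (sum-cong-≗ discrepancy)) (sum-sub f g))

module _ {n : ℕ} (i j : Fin n) {l : Fin n} where

  swap-at-i : toℕ l ≡ toℕ i → swap i j l ≡ j
  swap-at-i l≡i with toℕ l ℕP.≟ toℕ i
  ... | yes _   = refl
  ... | no  l≢i = ⊥-elim (l≢i l≡i)

  swap-at-j : toℕ l ≢ toℕ i → toℕ l ≡ toℕ j → swap i j l ≡ i
  swap-at-j l≢i l≡j with toℕ l ℕP.≟ toℕ i | toℕ l ℕP.≟ toℕ j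
  ... | yes l≡i | _       = ⊥-elim (l≢i l≡i)
  ... | no  _   | yes _   = refl
  ... | no  _   | no  l≢j = ⊥-elim (l≢j l≡j)

  swap-fixed : toℕ l ≢ toℕ i → toℕ l ≢ toℕ j → swap i j l ≡ l
  swap-fixed l≢i l≢j with toℕ l ℕP.≟ toℕ i | toℕ l ℕP.≟ toℕ j
  ... | yes l≡i | _       = ⊥-elim (l≢i l≡i)
  ... | no  _   | yes l≡j = ⊥-elim (l≢j l≡j)
  ... | no  _   | no  _   = refl

swap-involutive : ∀ {n} (i j l : Fin n) → swap i j (swap i j l) ≡ l
swap-involutive i j l = by-cases (toℕ l ℕP.≟ toℕ i) (toℕ l ℕP.≟ toℕ j) (toℕ j ℕP.≟ toℕ i)
  where
  open ≡-Reasoning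
  by-cases : Dec (toℕ l ≡ toℕ i) → Dec (toℕ l ≡ toℕ j) → Dec (toℕ j ≡ toℕ i) →
             swap i j (swap i j l) ≡ l
  by-cases (yes l≡i) _ (yes j≡i) = begin
    swap i j (swap i j l) ≡⟨ cong (swap i j) (swap-at-i i j l≡i) ⟩
    swap i j j            ≡⟨ swap-at-i i j j≡i ⟩
    j                     ≡⟨ FinP.toℕ-injective (trans j≡i (sym l≡i)) ⟩
    l                     ∎
  by-cases (yes l≡i) _ (no j≢i) = begin
    swap i j (swap i j l) ≡⟨ cong (swap i j) (swap-at-i i j l≡i) ⟩
    swap i j j            ≡⟨ swap-at-j i j j≢i refl ⟩
    i                     ≡⟨ FinP.toℕ-injective (sym l≡i) ⟩
    l                     ∎
  by-cases (no l≢i) (yes l≡j) _ = begin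
    swap i j (swap i j l) ≡⟨ cong (swap i j) (swap-at-j i j l≢i l≡j) ⟩
    swap i j i            ≡⟨ swap-at-i i j refl ⟩
    j                     ≡⟨ FinP.toℕ-injective (sym l≡j) ⟩
    l                     ∎
  by-cases (no l≢i) (no l≢j) _ =
    trans (cong (swap i j) (swap-fixed i j l≢i l≢j)) (swap-fixed i j l≢i l≢j)

data Shape (n : ℕ) : Set where
  transposition : (i j : Fin n) → toℕ i < toℕ j → Shape n
  diagonal      : Fin n → Shape n

IsTransposition : ∀ {n} → Shape n → Set
IsTransposition (transposition _ _ _) = ⊤
IsTransposition (diagonal _)          = ⊥

module _ {n : ℕ} where

  reflection : Shape n → ℤ → W n
  reflection (transposition i j _) = tr i j
  reflection (diagonal i)          = diag i

  shapePerm : Shape n → Fin n → Fin n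
  shapePerm (transposition i j _) = swap i j
  shapePerm (diagonal _)          = λ l → l

  shapePerm-involutive : ∀ s l → shapePerm s (shapePerm s l) ≡ l
  shapePerm-involutive (transposition i j _) = swap-involutive i j
  shapePerm-involutive (diagonal _)          = λ _ → refl

  generator : Shape n → Fin n → ℤ
  generator s = vec (reflection s 1ℤ)

  vec-reflection : ∀ s k l → vec (reflection s k) l ≡ k * generator s l
  vec-reflection (transposition i j _) k l with toℕ l ℕP.≟ toℕ i | toℕ l ℕP.≟ toℕ j
  ... | yes _ | _     = sym (trans (sym (ℤP.neg-distribʳ-* k 1ℤ)) (cong -_ (ℤP.*-identityʳ k)))
  ... | no _  | yes _ = sym (ℤP.*-identityʳ k)
  ... | no _  | no _  = sym (ℤP.*-zeroʳ k)
  vec-reflection (diagonal i) k l with toℕ l ℕP.≟ toℕ i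
  ... | yes _ = sym (ℤP.*-identityʳ k)
  ... | no _  = sym (ℤP.*-zeroʳ k)

  generator-transposition : ∀ i j (i<j : toℕ i < toℕ j) l →
                            generator (transposition i j i<j) l ≡ e j l - e i l
  generator-transposition i j i<j l with toℕ l ℕP.≟ toℕ i | toℕ l ℕP.≟ toℕ j
  ... | yes l≡i | yes l≡j = ⊥-elim (ℕP.<⇒≢ i<j (trans (sym l≡i) l≡j))
  ... | yes _   | no  _   = refl
  ... | no  _   | yes _   = refl
  ... | no  _   | no  _   = refl

  generator-diagonal : ∀ i l → generator (diagonal i) l ≡ e i l
  generator-diagonal i l with toℕ l ℕP.≟ toℕ i
  ... | yes _ = refl
  ... | no  _ = refl

module _ {n : ℕ} where

  σ : List (Shape n) → Fin n → Fin n
  σ []       l = l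
  σ (s ∷ ss) l = shapePerm s (σ ss l)

  σ⁻¹ : List (Shape n) → Fin n → Fin n
  σ⁻¹ []       l = l
  σ⁻¹ (s ∷ ss) l = σ⁻¹ ss (shapePerm s l)

  σ-σ⁻¹ : ∀ ss l → σ ss (σ⁻¹ ss l) ≡ l
  σ-σ⁻¹ []       l = refl
  σ-σ⁻¹ (s ∷ ss) l =
    trans (cong (shapePerm s) (σ-σ⁻¹ ss (shapePerm s l))) (shapePerm-involutive s l)

  σ⁻¹-σ : ∀ ss l → σ⁻¹ ss (σ ss l) ≡ l
  σ⁻¹-σ []       l = refl
  σ⁻¹-σ (s ∷ ss) l = trans (cong (σ⁻¹ ss) (shapePerm-involutive s (σ ss l))) (σ⁻¹-σ ss l)

  e-∘-σ : ∀ ss p l → e p (σ ss l) ≡ e (σ⁻¹ ss p) l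
  e-∘-σ ss = e-∘-inverse (σ-σ⁻¹ ss) (σ⁻¹-σ ss)

  lifts : List (Shape n) → (ℕ → ℤ) → List (W n)
  lifts []       ks = []
  lifts (s ∷ ss) ks = reflection s (ks 0) ∷ lifts ss (ks ∘ suc)

  perm-prod-lifts : ∀ ss ks l → perm (prod (lifts ss ks)) l ≡ σ ss l
  perm-prod-lifts []                         ks l = refl
  perm-prod-lifts (transposition i j _ ∷ ss) ks l =
    cong (swap i j) (perm-prod-lifts ss (ks ∘ suc) l)
  perm-prod-lifts (diagonal _ ∷ ss)          ks l = perm-prod-lifts ss (ks ∘ suc) l

  vecLifts : List (Shape n) → (ℕ → ℤ) → Fin n → ℤ
  vecLifts ss ks = vec (prod (lifts ss ks))

  vecLifts-∷ : ∀ s ss ks l →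
               vecLifts (s ∷ ss) ks l ≡ ks 0 * generator s (σ ss l) + vecLifts ss (ks ∘ suc) l
  vecLifts-∷ s ss ks l = cong (λ x → x + vecLifts ss (ks ∘ suc) l)
    (trans (cong (vec (reflection s (ks 0))) (perm-prod-lifts ss (ks ∘ suc) l))
           (vec-reflection s (ks 0) (σ ss l)))

  vecLifts-zero : ∀ ss l → vecLifts ss (λ _ → 0ℤ) l ≡ 0ℤ
  vecLifts-zero []       l = refl
  vecLifts-zero (s ∷ ss) l =
    trans (vecLifts-∷ s ss (λ _ → 0ℤ) l) (trans (ℤP.+-identityˡ _) (vecLifts-zero ss l))

  vecLifts-cong : ∀ ss {ks ms} → (∀ r → ks r ≡ ms r) → ∀ l → vecLifts ss ks l ≡ vecLifts ss ms l
  vecLifts-cong []       _     l = refl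
  vecLifts-cong (s ∷ ss) {ks} {ms} ks≗ms l = begin
    vecLifts (s ∷ ss) ks l
      ≡⟨ vecLifts-∷ s ss ks l ⟩
    ks 0 * generator s (σ ss l) + vecLifts ss (ks ∘ suc) l
      ≡⟨ cong₂ (λ k v → k * generator s (σ ss l) + v) (ks≗ms 0) (vecLifts-cong ss (ks≗ms ∘ suc) l) ⟩
    ms 0 * generator s (σ ss l) + vecLifts ss (ms ∘ suc) l
      ≡⟨ vecLifts-∷ s ss ms l ⟨
    vecLifts (s ∷ ss) ms l ∎
    where open ≡-Reasoning

  vecLifts-linear : ∀ a b ss ks ms l →
    vecLifts ss (λ r → a * ks r + b * ms r) l ≡ a * vecLifts ss ks l + b * vecLifts ss ms l
  vecLifts-linear a b []       ks ms l = sym (cong₂ _+_ (ℤP.*-zeroʳ a) (ℤP.*-zeroʳ b))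
  vecLifts-linear a b (s ∷ ss) ks ms l = begin
    vecLifts (s ∷ ss) (λ r → a * ks r + b * ms r) l
      ≡⟨ vecLifts-∷ s ss (λ r → a * ks r + b * ms r) l ⟩
    (a * ks 0 + b * ms 0) * g + vecLifts ss (λ r → a * ks (suc r) + b * ms (suc r)) l
      ≡⟨ cong (λ x → (a * ks 0 + b * ms 0) * g + x) (vecLifts-linear a b ss (ks ∘ suc) (ms ∘ suc) l) ⟩
    (a * ks 0 + b * ms 0) * g + (a * vecLifts ss (ks ∘ suc) l + b * vecLifts ss (ms ∘ suc) l)
      ≡⟨ distribute a b (ks 0) (ms 0) g (vecLifts ss (ks ∘ suc) l) (vecLifts ss (ms ∘ suc) l) ⟩
    a * (ks 0 * g + vecLifts ss (ks ∘ suc) l) + b * (ms 0 * g + vecLifts ss (ms ∘ suc) l)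
      ≡⟨ cong₂ (λ x y → a * x + b * y) (vecLifts-∷ s ss ks l) (vecLifts-∷ s ss ms l) ⟨
    a * vecLifts (s ∷ ss) ks l + b * vecLifts (s ∷ ss) ms l ∎
    where
    open ≡-Reasoning
    g = generator s (σ ss l)
    distribute : ∀ a b k m g x y →
                 (a * k + b * m) * g + (a * x + b * y) ≡ a * (k * g + x) + b * (m * g + y)
    distribute = solve-∀

-- The lattice of vectors of products of lifts

module _ {n : ℕ} (ss : List (Shape n)) where

  InLattice : (Fin n → ℤ) → Set
  InLattice f = Σ (ℕ → ℤ) λ ms → ∀ l → vecLifts ss ms l ≡ f l

  InLattice-cong : ∀ {f g} → (∀ l → f l ≡ g l) → InLattice f → InLattice g
  InLattice-cong f≗g (ms , eq) = ms , λ l → trans (eq l) (f≗g l)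

  InLattice-zero : InLattice (λ _ → 0ℤ)
  InLattice-zero = (λ _ → 0ℤ) , vecLifts-zero ss

  InLattice-lincomb : ∀ a b {f g} → InLattice f → InLattice g → InLattice (λ l → a * f l + b * g l)
  InLattice-lincomb a b (ks , eq) (ms , eq′) =
    (λ r → a * ks r + b * ms r) ,
    λ l → trans (vecLifts-linear a b ss ks ms l) (cong₂ (λ x y → a * x + b * y) (eq l) (eq′ l))

  InLattice-+ : ∀ {f g} → InLattice f → InLattice g → InLattice (λ l → f l + g l)
  InLattice-+ {f} {g} hf hg = InLattice-cong
    (λ l → cong₂ _+_ (ℤP.*-identityˡ (f l)) (ℤP.*-identityˡ (g l))) (InLattice-lincomb 1ℤ 1ℤ hf hg)

  InLattice-* : ∀ c {f} → InLattice f → InLattice (λ l → c * f l)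
  InLattice-* c {f} hf =
    InLattice-cong (λ l → ℤP.+-identityʳ (c * f l)) (InLattice-lincomb c 0ℤ hf hf)

  InLattice-sum : ∀ {m} (g : Fin m → Fin n → ℤ) → (∀ p → InLattice (g p)) →
                  InLattice (λ l → sum (λ p → g p l))
  InLattice-sum {zero}  g h = InLattice-zero
  InLattice-sum {suc m} g h = InLattice-+ (h Fin.zero) (InLattice-sum (g ∘ Fin.suc) (h ∘ Fin.suc))

  InLattice-all : (∀ p → InLattice (e p)) → ∀ f → InLattice f
  InLattice-all e∈L f = InLattice-cong (sum-e-expansion f)
    (InLattice-sum (λ p l → f p * e p l) (λ p → InLattice-* (f p) (e∈L p)))

  Linked : Fin n → Fin n → Set
  Linked p q = InLattice (λ l → e q l - e p l)

  Linked-refl : ∀ p → Linked p p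
  Linked-refl p = InLattice-cong (λ l → sym (ℤP.+-inverseʳ (e p l))) InLattice-zero

  Linked-sym : ∀ {p q} → Linked p q → Linked q p
  Linked-sym {p} {q} h = InLattice-cong (λ l → negate (e q l) (e p l)) (InLattice-* -1ℤ h)
    where
    negate : ∀ x y → -1ℤ * (x - y) ≡ y - x
    negate = solve-∀

  Linked-trans : ∀ {p q r} → Linked p q → Linked q r → Linked p r
  Linked-trans {p} {q} {r} h h′ =
    InLattice-cong (λ l → telescope (e p l) (e q l) (e r l)) (InLattice-+ h h′)
    where
    telescope : ∀ x y z → (y - x) + (z - y) ≡ z - x
    telescope = solve-∀

  InLattice-weight0 : ∀ p₀ → (∀ p → Linked p₀ p) → ∀ f → sum f ≡ 0ℤ → InLattice f
  InLattice-weight0 p₀ linked f weight0 = InLattice-cong expansion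
    (InLattice-sum (λ p l → f p * (e p l - e p₀ l)) (λ p → InLattice-* (f p) (linked p)))
    where
    open ≡-Reasoning
    split : ∀ x y z → x * (y - z) ≡ x * y + (- z) * x
    split = solve-∀
    expansion : ∀ l → sum (λ p → f p * (e p l - e p₀ l)) ≡ f l
    expansion l = begin
      sum (λ p → f p * (e p l - e p₀ l))
        ≡⟨ sum-cong-≗ (λ p → split (f p) (e p l) (e p₀ l)) ⟩
      sum (λ p → f p * e p l + (- e p₀ l) * f p)
        ≡⟨ ∑-distrib-+ (λ p → f p * e p l) (λ p → (- e p₀ l) * f p) ⟩
      sum (λ p → f p * e p l) + sum (λ p → (- e p₀ l) * f p)
        ≡⟨ cong₂ _+_ (sum-e-expansion f l) (sym (*-distribˡ-sum (- e p₀ l) f)) ⟩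
      f l + (- e p₀ l) * sum f
        ≡⟨ cong (λ x → f l + (- e p₀ l) * x) weight0 ⟩
      f l + (- e p₀ l) * 0ℤ
        ≡⟨ cong (λ x → f l + x) (ℤP.*-zeroʳ (- e p₀ l)) ⟩
      f l + 0ℤ
        ≡⟨ ℤP.+-identityʳ (f l) ⟩
      f l ∎

InLattice-∷ : ∀ {n} s (ss : List (Shape n)) {f} → InLattice ss f → InLattice (s ∷ ss) f
InLattice-∷ s ss (ms , eq) =
  cons , λ l → trans (vecLifts-∷ s ss cons l) (trans (ℤP.+-identityˡ _) (eq l))
  where
  cons : ℕ → ℤ
  cons zero    = 0ℤ
  cons (suc r) = ms r

generator∈Lattice : ∀ {n} s (ss : List (Shape n)) → InLattice (s ∷ ss) (generator s ∘ σ ss)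
generator∈Lattice s ss = unit , λ l → begin
  vecLifts (s ∷ ss) unit l
    ≡⟨ vecLifts-∷ s ss unit l ⟩
  1ℤ * generator s (σ ss l) + vecLifts ss (λ _ → 0ℤ) l
    ≡⟨ cong₂ _+_ (ℤP.*-identityˡ (generator s (σ ss l))) (vecLifts-zero ss l) ⟩
  generator s (σ ss l) + 0ℤ
    ≡⟨ ℤP.+-identityʳ (generator s (σ ss l)) ⟩
  generator s (σ ss l) ∎
  where
  open ≡-Reasoning
  unit : ℕ → ℤ
  unit zero    = 1ℤ
  unit (suc _) = 0ℤ

generator-transposition-∘σ : ∀ {n} (i j : Fin n) (i<j : toℕ i < toℕ j) ss l →
  generator (transposition i j i<j) (σ ss l) ≡ e (σ⁻¹ ss j) l - e (σ⁻¹ ss i) l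
generator-transposition-∘σ i j i<j ss l =
  trans (generator-transposition i j i<j (σ ss l)) (cong₂ _-_ (e-∘-σ ss j l) (e-∘-σ ss i l))

linked-transposition : ∀ {n} (i j : Fin n) (i<j : toℕ i < toℕ j) ss →
                       Linked (transposition i j i<j ∷ ss) (σ⁻¹ ss i) (σ⁻¹ ss j)
linked-transposition i j i<j ss = InLattice-cong (transposition i j i<j ∷ ss)
  (generator-transposition-∘σ i j i<j ss) (generator∈Lattice (transposition i j i<j) ss)

linked-step : ∀ {n} s (ss : List (Shape n)) x →
              Linked (s ∷ ss) (σ⁻¹ ss x) (σ⁻¹ ss (shapePerm s x))
linked-step (diagonal i) ss x = Linked-refl (diagonal i ∷ ss) (σ⁻¹ ss x)
linked-step (transposition i j i<j) ss x = by-cases (toℕ x ℕP.≟ toℕ i) (toℕ x ℕP.≟ toℕ j)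
  where
  ts = transposition i j i<j ∷ ss
  Linked′ : Fin _ → Fin _ → Set
  Linked′ a b = Linked ts (σ⁻¹ ss a) (σ⁻¹ ss b)
  by-cases : Dec (toℕ x ≡ toℕ i) → Dec (toℕ x ≡ toℕ j) → Linked′ x (swap i j x)
  by-cases (yes x≡i) _ =
    subst₂ Linked′ (FinP.toℕ-injective (sym x≡i)) (sym (swap-at-i i j x≡i))
      (linked-transposition i j i<j ss)
  by-cases (no x≢i) (yes x≡j) =
    subst₂ Linked′ (FinP.toℕ-injective (sym x≡j)) (sym (swap-at-j i j x≢i x≡j))
      (Linked-sym ts (linked-transposition i j i<j ss))
  by-cases (no x≢i) (no x≢j) =
    subst (Linked′ x) (sym (swap-fixed i j x≢i x≢j)) (Linked-refl ts (σ⁻¹ ss x))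

linked-σ : ∀ {n} (ss : List (Shape n)) q → Linked ss q (σ ss q)
linked-σ []       q = Linked-refl [] q
linked-σ (s ∷ ss) q = Linked-trans (s ∷ ss) to-q′ from-q′
  where
  q′ = σ⁻¹ ss (shapePerm s (σ ss q))
  to-q′ : Linked (s ∷ ss) q q′
  to-q′ = subst (λ a → Linked (s ∷ ss) a q′) (σ⁻¹-σ ss q) (linked-step s ss (σ ss q))
  from-q′ : Linked (s ∷ ss) q′ (σ (s ∷ ss) q)
  from-q′ = subst (Linked (s ∷ ss) q′) (σ-σ⁻¹ ss _) (InLattice-∷ s ss (linked-σ ss q′))

cyc-suc : ∀ {n} m (k : Fin n) → suc (toℕ k) < m → m ≤ n → toℕ (cyc m k) ≡ suc (toℕ k)
cyc-suc {n} m k 1+k<m m≤n with suc (toℕ k) ℕP.<? m | suc (toℕ k) ℕP.<? n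
... | yes _     | yes 1+k<n = FinP.toℕ-fromℕ< 1+k<n
... | yes _     | no  1+k≮n = ⊥-elim (1+k≮n (ℕP.<-≤-trans 1+k<m m≤n))
... | no  1+k≮m | _         = ⊥-elim (1+k≮m 1+k<m)

linked-along-cycle : ∀ {n} (ss : List (Shape (suc n))) m → m ≤ suc n → (∀ q → σ ss q ≡ cyc m q) →
                     ∀ k → toℕ k < m → Linked ss Fin.zero k
linked-along-cycle ss m m≤ σ≗cyc k k<m =
  subst (Linked ss Fin.zero) (FinP.fromℕ<-toℕ k (in-range k<m)) (reach (toℕ k) k<m)
  where
  open ≡-Reasoning
  in-range : ∀ {t} → t < m → t < suc _
  in-range t<m = ℕP.<-≤-trans t<m m≤
  point : ∀ t → t < m → Fin _
  point t t<m = fromℕ< (in-range t<m)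
  σ-point : ∀ t (1+t<m : suc t < m) (t<m : t < m) → σ ss (point t t<m) ≡ point (suc t) 1+t<m
  σ-point t 1+t<m t<m = trans (σ≗cyc (point t t<m)) (FinP.toℕ-injective (begin
    toℕ (cyc m (point t t<m))
      ≡⟨ cyc-suc m (point t t<m) (subst (λ x → suc x < m) (sym toℕ-point) 1+t<m) m≤ ⟩
    suc (toℕ (point t t<m))   ≡⟨ cong suc toℕ-point ⟩
    suc t                     ≡⟨ FinP.toℕ-fromℕ< (in-range 1+t<m) ⟨
    toℕ (point (suc t) 1+t<m) ∎))
    where
    toℕ-point = FinP.toℕ-fromℕ< (in-range t<m)
  reach : ∀ t (t<m : t < m) → Linked ss Fin.zero (point t t<m)
  reach zero    _     = Linked-refl ss Fin.zero
  reach (suc t) 1+t<m = Linked-trans ss (reach t t<m)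
    (subst (Linked ss (point t t<m)) (σ-point t 1+t<m t<m) (linked-σ ss (point t t<m)))
    where
    t<m = ℕP.<-trans (ℕP.n<1+n t) 1+t<m

diagonal-or-transpositions : ∀ {n} (ss : List (Shape n)) →
                             (Σ (Fin n) λ q → InLattice ss (e q)) ⊎ All IsTransposition ss
diagonal-or-transpositions []                           = inj₂ []
diagonal-or-transpositions (diagonal i ∷ ss)            = inj₁ (σ⁻¹ ss i ,
  InLattice-cong (diagonal i ∷ ss) (λ l → trans (generator-diagonal i (σ ss l)) (e-∘-σ ss i l))
    (generator∈Lattice (diagonal i) ss))
diagonal-or-transpositions (transposition i j i<j ∷ ss) with diagonal-or-transpositions ss
... | inj₁ (q , e∈L)         = inj₁ (q , InLattice-∷ (transposition i j i<j) ss e∈L)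
... | inj₂ all-transposition = inj₂ (tt ∷ all-transposition)

sum-vecLifts-transpositions : ∀ {n} (ss : List (Shape n)) → All IsTransposition ss →
                              ∀ ks → sum (vecLifts ss ks) ≡ 0ℤ
sum-vecLifts-transpositions {n} [] [] ks = sum-replicate-zero n
sum-vecLifts-transpositions (transposition i j i<j ∷ ss) (_ ∷ rest) ks = begin
  sum (vecLifts (s ∷ ss) ks)
    ≡⟨ sum-cong-≗ (vecLifts-∷ s ss ks) ⟩
  sum (λ l → ks 0 * generator s (σ ss l) + vecLifts ss (ks ∘ suc) l)
    ≡⟨ ∑-distrib-+ (λ l → ks 0 * generator s (σ ss l)) (vecLifts ss (ks ∘ suc)) ⟩
  sum (λ l → ks 0 * generator s (σ ss l)) + sum (vecLifts ss (ks ∘ suc))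
    ≡⟨ cong₂ _+_ (sym (*-distribˡ-sum (ks 0) (generator s ∘ σ ss)))
                 (sum-vecLifts-transpositions ss rest (ks ∘ suc)) ⟩
  ks 0 * sum (generator s ∘ σ ss) + 0ℤ
    ≡⟨ cong (λ x → ks 0 * x + 0ℤ) weight-generator ⟩
  ks 0 * 0ℤ + 0ℤ
    ≡⟨ cong (λ x → x + 0ℤ) (ℤP.*-zeroʳ (ks 0)) ⟩
  0ℤ ∎
  where
  open ≡-Reasoning
  s = transposition i j i<j
  weight-generator : sum (generator s ∘ σ ss) ≡ 0ℤ
  weight-generator = begin
    sum (generator s ∘ σ ss)
      ≡⟨ sum-cong-≗ (generator-transposition-∘σ i j i<j ss) ⟩
    sum (λ l → e (σ⁻¹ ss j) l - e (σ⁻¹ ss i) l)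
      ≡⟨ sum-sub (e (σ⁻¹ ss j)) (e (σ⁻¹ ss i)) ⟩
    sum (e (σ⁻¹ ss j)) - sum (e (σ⁻¹ ss i))
      ≡⟨ cong₂ _-_ (sum-e (σ⁻¹ ss j)) (sum-e (σ⁻¹ ss i)) ⟩
    1ℤ - 1ℤ ∎

linked-elsewhere-or-vanishing : ∀ {n} (ss : List (Shape n)) → All IsTransposition ss → ∀ z →
  (Σ (Fin n) λ q → q ≢ z × Linked ss z q) ⊎ (∀ ks → vecLifts ss ks z ≡ 0ℤ)
linked-elsewhere-or-vanishing []       []         z = inj₂ (λ _ → refl)
linked-elsewhere-or-vanishing (transposition i j i<j ∷ ss) (_ ∷ rest) z
  with linked-elsewhere-or-vanishing ss rest z
... | inj₁ (q , q≢z , linked) = inj₁ (q , q≢z , InLattice-∷ (transposition i j i<j) ss linked)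
... | inj₂ vanishing = by-cases (toℕ z ℕP.≟ toℕ (σ⁻¹ ss i)) (toℕ z ℕP.≟ toℕ (σ⁻¹ ss j))
  where
  ts = transposition i j i<j ∷ ss
  σ⁻¹i≢σ⁻¹j : σ⁻¹ ss i ≢ σ⁻¹ ss j
  σ⁻¹i≢σ⁻¹j eq =
    ℕP.<⇒≢ i<j (cong toℕ (trans (sym (σ-σ⁻¹ ss i)) (trans (cong (σ ss) eq) (σ-σ⁻¹ ss j))))
  by-cases : Dec (toℕ z ≡ toℕ (σ⁻¹ ss i)) → Dec (toℕ z ≡ toℕ (σ⁻¹ ss j)) →
             (Σ (Fin _) λ q → q ≢ z × Linked ts z q) ⊎ (∀ ks → vecLifts ts ks z ≡ 0ℤ)
  by-cases (yes z≡i′) _ with FinP.toℕ-injective z≡i′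
  ... | refl = inj₁ (σ⁻¹ ss j , σ⁻¹i≢σ⁻¹j ∘ sym , linked-transposition i j i<j ss)
  by-cases (no _) (yes z≡j′) with FinP.toℕ-injective z≡j′
  ... | refl = inj₁ (σ⁻¹ ss i , σ⁻¹i≢σ⁻¹j , Linked-sym ts (linked-transposition i j i<j ss))
  by-cases (no z≢i′) (no z≢j′) = inj₂ λ ks → begin
    vecLifts ts ks z
      ≡⟨ vecLifts-∷ (transposition i j i<j) ss ks z ⟩
    ks 0 * generator (transposition i j i<j) (σ ss z) + vecLifts ss (ks ∘ suc) z
      ≡⟨ cong₂ (λ x y → ks 0 * x + y) (generator-transposition-∘σ i j i<j ss z)
                                      (vanishing (ks ∘ suc)) ⟩
    ks 0 * (e (σ⁻¹ ss j) z - e (σ⁻¹ ss i) z) + 0ℤ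
      ≡⟨ cong₂ (λ x y → ks 0 * (x - y) + 0ℤ) (e-≢ z≢j′) (e-≢ z≢i′) ⟩
    ks 0 * 0ℤ + 0ℤ
      ≡⟨ cong (λ x → x + 0ℤ) (ℤP.*-zeroʳ (ks 0)) ⟩
    0ℤ ∎
    where open ≡-Reasoning

-- Lifting factorizations modulo d

module _ (d : ℕ) where

  shift : (ℕ → ℤ) → (ℕ → ℤ) → ℕ → ℤ
  shift ks ms r = ks r - + d * ms r

  reflection-shift-≈[] : ∀ {n} (s : Shape n) k m → reflection s (k - + d * m) ≈[ d ] reflection s k
  reflection-shift-≈[] s k m = same-perm s , λ l →
    quotient⇒≡[] (vec (reflection s (k - + d * m)) l) (vec (reflection s k) l) (- (m * generator s l))
      (begin
        vec (reflection s (k - + d * m)) l - vec (reflection s k) l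
          ≡⟨ cong₂ _-_ (vec-reflection s (k - + d * m) l) (vec-reflection s k l) ⟩
        (k - + d * m) * generator s l - k * generator s l
          ≡⟨ cancel k (+ d) m (generator s l) ⟩
        - (m * generator s l) * + d ∎)
    where
    open ≡-Reasoning
    cancel : ∀ k d m g → (k - d * m) * g - k * g ≡ - (m * g) * d
    cancel = solve-∀
    same-perm : ∀ s l → perm (reflection s (k - + d * m)) l ≡ perm (reflection s k) l
    same-perm (transposition _ _ _) l = refl
    same-perm (diagonal _)          l = refl

  lifts-shift-≈[] : ∀ {n} (ss : List (Shape n)) ks ms →
                    Pointwise _≈[ d ]_ (lifts ss (shift ks ms)) (lifts ss ks)
  lifts-shift-≈[] []       ks ms = []
  lifts-shift-≈[] (s ∷ ss) ks ms =
    reflection-shift-≈[] s (ks 0) (ms 0) ∷ lifts-shift-≈[] ss (ks ∘ suc) (ms ∘ suc)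

  vecLifts-shift : ∀ {n} (ss : List (Shape n)) ks ms l →
                   vecLifts ss (shift ks ms) l ≡ vecLifts ss ks l - + d * vecLifts ss ms l
  vecLifts-shift ss ks ms l = begin
    vecLifts ss (shift ks ms) l
      ≡⟨ vecLifts-cong ss (λ r → as-lincomb (ks r) (+ d) (ms r)) l ⟩
    vecLifts ss (λ r → 1ℤ * ks r + (- + d) * ms r) l
      ≡⟨ vecLifts-linear 1ℤ (- + d) ss ks ms l ⟩
    1ℤ * vecLifts ss ks l + (- + d) * vecLifts ss ms l
      ≡⟨ as-lincomb (vecLifts ss ks l) (+ d) (vecLifts ss ms l) ⟨
    vecLifts ss ks l - + d * vecLifts ss ms l ∎
    where
    open ≡-Reasoning
    as-lincomb : ∀ k d m → k - d * m ≡ 1ℤ * k + (- d) * m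
    as-lincomb = solve-∀

  record ShapedReflection {n} (P : Shape n → Set) (Refl∞ : W n → Set) (t : W n) : Set where
    field
      shape         : Shape n
      shape-ok      : P shape
      base          : ℤ
      projects      : reflection shape base ≈[ d ] t
      lifts-reflect : ∀ m → Refl∞ (reflection shape (base - + d * m))

  record ShapedFactorization {n} (P : Shape n → Set) (Refl∞ : W n → Set) (ts : List (W n)) : Set where
    field
      shapes        : List (Shape n)
      shapes-ok     : All P shapes
      bases         : ℕ → ℤ
      projects      : Pointwise _≈[ d ]_ (lifts shapes bases) ts
      lifts-reflect : ∀ ms → All Refl∞ (lifts shapes (shift bases ms))

  shapedFactorization : ∀ {n} {R : W n → Set} {P Refl∞} →
                        (∀ {t} → R t → ShapedReflection P Refl∞ t) →
                        ∀ {ts} → All R ts → ShapedFactorization P Refl∞ ts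
  shapedFactorization shaped []         = record
    { shapes = [] ; shapes-ok = [] ; bases = λ _ → 0ℤ ; projects = [] ; lifts-reflect = λ _ → [] }
  shapedFactorization shaped (rt ∷ rts) = record
    { shapes        = shape ∷ F.shapes
    ; shapes-ok     = shape-ok ∷ F.shapes-ok
    ; bases         = bases
    ; projects      = projects ∷ F.projects
    ; lifts-reflect = λ ms → lifts-reflect (ms 0) ∷ F.lifts-reflect (ms ∘ suc)
    }
    where
    open ShapedReflection (shaped rt)
    module F = ShapedFactorization (shapedFactorization shaped rts)
    bases : ℕ → ℤ
    bases zero    = base
    bases (suc r) = F.bases r

  shapedReflD1 : ∀ {n} {t : W n} → ReflD1 d t → ShapedReflection (λ _ → ⊤) ReflI1 t
  shapedReflD1 {t = t} (inj₁ (i , j , k , i<j , t≈)) = record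
    { shape = transposition i j i<j ; shape-ok = tt ; base = k
    ; projects = ≈[]-sym {x = t} {tr i j k} t≈
    ; lifts-reflect = λ m → inj₁ (i , j , k - + d * m , i<j , (λ _ → refl) , (λ _ → refl))
    }
  shapedReflD1 {t = t} (inj₂ (i , k , k≢0 , t≈)) = record
    { shape = diagonal i ; shape-ok = tt ; base = k
    ; projects = ≈[]-sym {x = t} {diag i k} t≈
    ; lifts-reflect = λ m → inj₂ (i , k - + d * m , nonzero m , (λ _ → refl) , (λ _ → refl))
    }
    where
    nonzero : ∀ m → k - + d * m ≢ 0ℤ
    nonzero m eq = k≢0 (quotient⇒≡[] k 0ℤ m (begin
      k - 0ℤ                  ≡⟨ regroup k (+ d) m ⟩
      (k - + d * m) + m * + d ≡⟨ cong (λ x → x + m * + d) eq ⟩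
      0ℤ + m * + d            ≡⟨ ℤP.+-identityˡ (m * + d) ⟩
      m * + d                 ∎))
      where
      open ≡-Reasoning
      regroup : ∀ k d m → k - 0ℤ ≡ (k - d * m) + m * d
      regroup = solve-∀

  shapedReflDD : ∀ {n} {t : W n} → ReflDD d t → ShapedReflection IsTransposition ReflII t
  shapedReflDD {t = t} (i , j , k , i<j , t≈) = record
    { shape = transposition i j i<j ; shape-ok = tt ; base = k
    ; projects = ≈[]-sym {x = t} {tr i j k} t≈
    ; lifts-reflect = λ m → i , j , k - + d * m , i<j , (λ _ → refl) , (λ _ → refl)
    }

  corrected : ∀ {n} (ss : List (Shape n)) ks (c : W n) (δ : Fin n → ℤ) →
              (∀ l → σ ss l ≡ perm c l) → (∀ l → vecLifts ss ks l - vec c l ≡ δ l * + d) →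
              InLattice ss δ → Σ (ℕ → ℤ) λ ms → prod (lifts ss (shift ks ms)) ≈∞ c
  corrected ss ks c δ σ≗c discrepancy (ms , ms↦δ) = ms ,
    (λ l → trans (perm-prod-lifts ss (shift ks ms) l) (σ≗c l)) ,
    λ l → begin
      vecLifts ss (shift ks ms) l
        ≡⟨ vecLifts-shift ss ks ms l ⟩
      vecLifts ss ks l - + d * vecLifts ss ms l
        ≡⟨ cong (λ x → vecLifts ss ks l - + d * x) (ms↦δ l) ⟩
      vecLifts ss ks l - + d * δ l
        ≡⟨ cong (λ x → vecLifts ss ks l - x) (ℤP.*-comm (+ d) (δ l)) ⟩
      vecLifts ss ks l - δ l * + d
        ≡⟨ cong (λ x → vecLifts ss ks l - x) (discrepancy l) ⟨
      vecLifts ss ks l - (vecLifts ss ks l - vec c l)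
        ≡⟨ cancel (vecLifts ss ks l) (vec c l) ⟩
      vec c l ∎
    where
    open ≡-Reasoning
    cancel : ∀ x y → x - (x - y) ≡ y
    cancel = solve-∀

  liftFactorization : ∀ {n} {P : Shape n → Set} {Refl∞ ts} {c : W n} →
    (F : ShapedFactorization P Refl∞ ts) → prod ts ≈[ d ] c →
    (let open ShapedFactorization F in
      ∀ δ → (∀ l → σ shapes l ≡ perm c l) → (∀ l → vecLifts shapes bases l - vec c l ≡ δ l * + d) →
      InLattice shapes δ) →
    Σ (List (W n)) λ ts̃ → All Refl∞ ts̃ × (prod ts̃ ≈∞ c) × Pointwise (Proj d) ts̃ ts
  liftFactorization {ts = ts} {c} F prod≈c discrepancy∈Lattice =
    lifts shapes (shift bases ms) , lifts-reflect ms , prod≈∞c ,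
    Pointwise.transitive (λ {x} {y} {z} → ≈[]-trans {x = x} {y} {z})
      (lifts-shift-≈[] shapes bases ms) projects
    where
    open ShapedFactorization F
    base-prod≈c : prod (lifts shapes bases) ≈[ d ] c
    base-prod≈c =
      ≈[]-trans {x = prod (lifts shapes bases)} {prod ts} {c} (prod-cong-≈[] projects) prod≈c
    σ≗c : ∀ l → σ shapes l ≡ perm c l
    σ≗c l = trans (sym (perm-prod-lifts shapes bases l)) (proj₁ base-prod≈c l)
    quotient : ∀ l → Σ ℤ λ q → vecLifts shapes bases l - vec c l ≡ q * + d
    quotient l = ≡[]⇒quotient (vecLifts shapes bases l) (vec c l) (proj₂ base-prod≈c l)
    δ : Fin _ → ℤ
    δ = proj₁ ∘ quotient
    fixed = corrected shapes bases c δ σ≗c (proj₂ ∘ quotient)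
                      (discrepancy∈Lattice δ σ≗c (proj₂ ∘ quotient))
    ms = proj₁ fixed
    prod≈∞c = proj₂ fixed

c₁-vec : ∀ m l → vec (c₁ {suc m}) l ≡ e (fromℕ m) l
c₁-vec m l with toℕ l ℕP.≟ m
... | yes l≡m = sym (e-≡ (trans l≡m (sym (FinP.toℕ-fromℕ m))))
... | no  l≢m = sym (e-≢ (λ l≡ → l≢m (trans l≡ (FinP.toℕ-fromℕ m))))

sum-c₁ : ∀ m → sum (vec (c₁ {suc m})) ≡ 1ℤ
sum-c₁ m = trans (sum-cong-≗ (c₁-vec m)) (sum-e (fromℕ m))

module _ (m : ℕ) where

  penultimate last : Fin (suc (suc m))
  penultimate = Fin.inject₁ (fromℕ m)
  last        = fromℕ (suc m)

  private
    toℕ-penultimate : toℕ penultimate ≡ m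
    toℕ-penultimate = trans (FinP.toℕ-inject₁ (fromℕ m)) (FinP.toℕ-fromℕ m)

    toℕ-last : toℕ last ≡ suc m
    toℕ-last = FinP.toℕ-fromℕ (suc m)

  toℕ<last : ∀ p → p ≢ last → toℕ p < suc m
  toℕ<last p p≢last =
    ℕP.≤∧≢⇒< (ℕP.≤-pred (FinP.toℕ<n p)) (λ p≡ → p≢last (FinP.toℕ-injective (trans p≡ (sym toℕ-last))))

  c₂-vec : ∀ l → vec (c₂ {suc (suc m)}) l ≡ e penultimate l - e last l
  c₂-vec l with toℕ l ℕP.≟ m | toℕ l ℕP.≟ suc m
  ... | yes l≡m | _ =
    sym (cong₂ _-_ (e-≡ (trans l≡m (sym toℕ-penultimate)))
                   (e-≢ (λ l≡ → ℕP.<⇒≢ (ℕP.n<1+n m) (trans (sym l≡m) (trans l≡ toℕ-last)))))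
  ... | no l≢m | yes l≡1+m =
    sym (cong₂ _-_ (e-≢ (λ l≡ → l≢m (trans l≡ toℕ-penultimate)))
                   (e-≡ (trans l≡1+m (sym toℕ-last))))
  ... | no l≢m | no l≢1+m =
    sym (cong₂ _-_ (e-≢ (λ l≡ → l≢m (trans l≡ toℕ-penultimate)))
                   (e-≢ (λ l≡ → l≢1+m (trans l≡ toℕ-last))))

  c₂-last : vec (c₂ {suc (suc m)}) last ≡ -1ℤ
  c₂-last = trans (c₂-vec last) (cong₂ _-_ (e-≢ last≢penultimate) (e-≡ refl))
    where
    last≢penultimate : toℕ last ≢ toℕ penultimate
    last≢penultimate eq = ℕP.<⇒≢ (ℕP.n<1+n m) (sym (trans (sym toℕ-last) (trans eq toℕ-penultimate)))

  sum-c₂ : sum (vec (c₂ {suc (suc m)})) ≡ 0ℤ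
  sum-c₂ = trans (sum-cong-≗ c₂-vec)
    (trans (sum-sub (e penultimate) (e last)) (cong₂ _-_ (sum-e penultimate) (sum-e last)))

discrepancy∈Lattice-c₁ : ∀ {m d} → 2 ≤ d → (ss : List (Shape (suc m))) → ∀ ks δ →
  (∀ l → σ ss l ≡ cyc (suc m) l) → (∀ l → vecLifts ss ks l - vec c₁ l ≡ δ l * + d) →
  InLattice ss δ
discrepancy∈Lattice-c₁ {m} {d} 2≤d ss ks δ σ≗cyc discrepancy with diagonal-or-transpositions ss
... | inj₁ (q , e_q∈L) = InLattice-all ss e∈L δ
  where
  linked : ∀ p → Linked ss Fin.zero p
  linked p = linked-along-cycle ss (suc m) ℕP.≤-refl σ≗cyc p (FinP.toℕ<n p)
  cancel : ∀ x y → (x - y) + y ≡ x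
  cancel = solve-∀
  e∈L : ∀ p → InLattice ss (e p)
  e∈L p = InLattice-cong ss (λ l → cancel (e p l) (e q l))
    (InLattice-+ ss (Linked-trans ss (Linked-sym ss (linked q)) (linked p)) e_q∈L)
... | inj₂ all-transposition = ⊥-elim (≥2∤unit 2≤d refl (divides (sum δ) (sym (begin
  sum δ * + d
    ≡⟨ sum-discrepancy d (vecLifts ss ks) (vec (c₁ {suc m})) δ discrepancy ⟩
  sum (vecLifts ss ks) - sum (vec (c₁ {suc m}))
    ≡⟨ cong₂ _-_ (sum-vecLifts-transpositions ss all-transposition ks) (sum-c₁ m) ⟩
  0ℤ - 1ℤ ∎))))
  where open ≡-Reasoning

discrepancy∈Lattice-c₂ : ∀ {m d} → 2 ≤ d → (ss : List (Shape (suc (suc m)))) →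
  All IsTransposition ss → ∀ ks δ →
  (∀ l → σ ss l ≡ cyc (suc m) l) → (∀ l → vecLifts ss ks l - vec c₂ l ≡ δ l * + d) →
  InLattice ss δ
discrepancy∈Lattice-c₂ {m} {d} 2≤d ss all-transposition ks δ σ≗cyc discrepancy =
  InLattice-weight0 ss Fin.zero linked δ weight0
  where
  open ≡-Reasoning

  linked-below : ∀ p → p ≢ last m → Linked ss Fin.zero p
  linked-below p p≢last =
    linked-along-cycle ss (suc m) (ℕP.n≤1+n (suc m)) σ≗cyc p (toℕ<last m p p≢last)

  linked-last : Linked ss Fin.zero (last m)
  linked-last with linked-elsewhere-or-vanishing ss all-transposition (last m)
  ... | inj₁ (q , q≢last , last~q) = Linked-trans ss (linked-below q q≢last) (Linked-sym ss last~q)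
  ... | inj₂ vanishing = ⊥-elim (≥2∤unit 2≤d refl (divides (δ (last m)) (begin
    1ℤ                                            ≡⟨ cong₂ _-_ (vanishing ks) (c₂-last m) ⟨
    vecLifts ss ks (last m) - vec c₂ (last m)     ≡⟨ discrepancy (last m) ⟩
    δ (last m) * + d                              ∎)))

  linked : ∀ p → Linked ss Fin.zero p
  linked p with p FinP.≟ last m
  ... | yes refl   = linked-last
  ... | no  p≢last = linked-below p p≢last

  weight0 : sum δ ≡ 0ℤ
  weight0 with ℤP.i*j≡0⇒i≡0∨j≡0 (sum δ) (begin
    sum δ * + d
      ≡⟨ sum-discrepancy d (vecLifts ss ks) (vec (c₂ {suc (suc m)})) δ discrepancy ⟩
    sum (vecLifts ss ks) - sum (vec (c₂ {suc (suc m)}))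
      ≡⟨ cong₂ _-_ (sum-vecLifts-transpositions ss all-transposition ks) (sum-c₂ m) ⟩
    0ℤ - 0ℤ ∎)
  ... | inj₁ sum≡0 = sum≡0
  ... | inj₂ d≡0   = ⊥-elim (ℕP.<⇒≢ (ℕP.<-trans ℕP.0<1+n 2≤d) (sym (cong ℤ.∣_∣ d≡0)))

liftFactorization-c₁ : ∀ {m} d → 2 ≤ d → (ts : List (W (suc m))) → All (ReflD1 d) ts →
  prod ts ≈[ d ] c₁ →
  Σ (List (W (suc m))) λ ts̃ → All ReflI1 ts̃ × (prod ts̃ ≈∞ c₁) × Pointwise (Proj d) ts̃ ts
liftFactorization-c₁ d 2≤d ts refls prod≈c₁ =
  liftFactorization d F prod≈c₁ (discrepancy∈Lattice-c₁ 2≤d shapes bases)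
  where
  F = shapedFactorization d (shapedReflD1 d) refls
  open ShapedFactorization F

liftFactorization-c₂ : ∀ {m} d → 2 ≤ d → (ts : List (W (suc (suc m)))) → All (ReflDD d) ts →
  prod ts ≈[ d ] c₂ →
  Σ (List (W (suc (suc m)))) λ ts̃ → All ReflII ts̃ × (prod ts̃ ≈∞ c₂) × Pointwise (Proj d) ts̃ ts
liftFactorization-c₂ d 2≤d ts refls prod≈c₂ =
  liftFactorization d F prod≈c₂ (discrepancy∈Lattice-c₂ 2≤d shapes shapes-ok bases)
  where
  F = shapedFactorization d (shapedReflDD d) refls
  open ShapedFactorization F

lemma4p1 : ((n d : ℕ) → 2 ≤ n → 2 ≤ d → (ts : List (W n)) →
    All (ReflD1 d) ts → prod ts ≈[ d ] c₁ →
    Σ (List (W n)) λ ts̃ →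
    All ReflI1 ts̃ × (prod ts̃ ≈∞ c₁) × Pointwise (Proj d) ts̃ ts)
    ×
    ((n d : ℕ) → 2 ≤ n → 2 ≤ d → (ts : List (W n)) →
    All (ReflDD d) ts → prod ts ≈[ d ] c₂ →
    Σ (List (W n)) λ ts̃ →
    All ReflII ts̃ × (prod ts̃ ≈∞ c₂) × Pointwise (Proj d) ts̃ ts)
lemma4p1 =
  (λ { (suc m) d _ 2≤d → liftFactorization-c₁ d 2≤d }) ,
  (λ { (suc zero) d (s≤s ()) ; (suc (suc m)) d _ 2≤d → liftFactorization-c₂ d 2≤d })
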